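{- Let $A,B\in\mathbb{Z}[t]$ with $A^2-4B$ not a square in $\mathbb{Z}[t]$, and let $E:y^2=x^3+Ax^2+Bx$ be a nonconstant elliptic curve over $\mathbb{Q}(t)$; let $D=B^2(A^2-4B)$ be the discriminant of $x^3+Ax^2+Bx$. Assume $t_0\in\mathbb{Q}$ satisfies: for each factor $h$ of $B$ or of $A^2-4B$ in $\mathbb{Z}[t]$, if $h(t_0)$ is a square in $\mathbb{Q}$ then $h$ is a square in $\mathbb{Z}[t]$. Then (i) $D(t_0)\neq 0$; and (ii) the polynomial $x^3+A(t_0)x^2+B(t_0)x$ has exactly one $\mathbb{Q}$-rational root.
   Context: An elliptic curve over $\mathbb{Q}(t)$ is called nonconstant if it is not isomorphic over $\mathbb{Q}(t)$ to an elliptic curve defined over $\mathbb{Q}$. -}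

module Defs where

open import Data.Nat using (ℕ; zero; suc)
open import Data.Integer as ℤ using (ℤ; +_)
open import Data.Rational as ℚ using (ℚ; 0ℚ; ↥_; ↧_)
open import Data.List using (List; []; _∷_; map)
open import Data.Product using (Σ; ∃; _×_; _,_; proj₁)
open import Relation.Binary.PropositionalEquality using (_≡_)
open import Relation.Nullary using (¬_)

-- Polynomials in ℤ[t], as coefficient lists (constant term first).
-- Equality is coefficientwise (trailing zeros are irrelevant).

Poly : Set
Poly = List ℤ

coeff : Poly → ℕ → ℤ
coeff []       _       = + 0
coeff (a ∷ p)  zero    = a
coeff (a ∷ p)  (suc n) = coeff p n

infix 4 _≈ₚ_
_≈ₚ_ : Poly → Poly → Set
p ≈ₚ q = ∀ n → coeff p n ≡ coeff q n

infixl 6 _+ₚ_ _-ₚ_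
infixl 7 _*ₚ_

_+ₚ_ : Poly → Poly → Poly
[]      +ₚ q       = q
(a ∷ p) +ₚ []      = a ∷ p
(a ∷ p) +ₚ (b ∷ q) = (a ℤ.+ b) ∷ (p +ₚ q)

negₚ : Poly → Poly
negₚ = map (λ z → ℤ.- z)

_-ₚ_ : Poly → Poly → Poly
p -ₚ q = p +ₚ negₚ q

_*ₚ_ : Poly → Poly → Poly
[]      *ₚ q = []
(a ∷ p) *ₚ q = map (a ℤ.*_) q +ₚ (+ 0 ∷ (p *ₚ q))

constₚ : ℤ → Poly
constₚ c = c ∷ []

0ₚ : Poly
0ₚ = []

infix 4 _∣ₚ_
_∣ₚ_ : Poly → Poly → Set
h ∣ₚ f = Σ Poly λ g → h *ₚ g ≈ₚ f

IsSquareℤ[t] : Poly → Set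
IsSquareℤ[t] f = Σ Poly λ g → g *ₚ g ≈ₚ f

toℚ : ℤ → ℚ
toℚ z = z ℚ./ 1

eval : Poly → ℚ → ℚ
eval []      x = 0ℚ
eval (a ∷ p) x = toℚ a ℚ.+ x ℚ.* eval p x

IsSquareℚ : ℚ → Set
IsSquareℚ q = Σ ℚ λ r → r ℚ.* r ≡ q

discQuad : Poly → Poly → Poly
discQuad A B = A *ₚ A -ₚ constₚ (+ 4) *ₚ B

Dpoly : Poly → Poly → Poly
Dpoly A B = B *ₚ B *ₚ discQuad A B

-- E is an elliptic curve over ℚ(t): its discriminant 16·D is nonzero
IsElliptic : Poly → Poly → Set
IsElliptic A B = ¬ (Dpoly A B ≈ₚ 0ₚ)

-- The rational function field ℚ(t), as fractions of integer polynomials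
-- with nonzero denominator (equality by cross multiplication).

record Frac : Set where
  constructor _⁄_
  field
    num : Poly
    den : Poly

open Frac public

WF : Frac → Set
WF f = ¬ (den f ≈ₚ 0ₚ)

infix 4 _≈F_
_≈F_ : Frac → Frac → Set
f ≈F g = num f *ₚ den g ≈ₚ num g *ₚ den f

infixl 6 _+F_ _-F_
infixl 7 _*F_

_+F_ : Frac → Frac → Frac
f +F g = (num f *ₚ den g +ₚ num g *ₚ den f) ⁄ (den f *ₚ den g)

_*F_ : Frac → Frac → Frac
f *F g = (num f *ₚ num g) ⁄ (den f *ₚ den g)

negF : Frac → Frac
negF f = negₚ (num f) ⁄ den f

_-F_ : Frac → Frac → Frac
f -F g = f +F negF g

polyF : Poly → Frac
polyF p = p ⁄ constₚ (+ 1)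

intF : ℤ → Frac
intF z = polyF (constₚ z)

ratF : ℚ → Frac
ratF q = constₚ (↥ q) ⁄ constₚ (↧ q)

0F : Frac
0F = polyF 0ₚ

-- Weierstrass equations over ℚ: y² + a₁xy + a₃y = x³ + a₂x² + a₄x + a₆

record Weierstrassℚ : Set where
  constructor weier
  field
    a₁ a₂ a₃ a₄ a₆ : ℚ

-- discriminant of a Weierstrass equation over ℚ (Silverman III.1)
Δℚ : Weierstrassℚ → ℚ
Δℚ (weier a₁ a₂ a₃ a₄ a₆) =
  let n : ℤ → ℚ
      n = toℚ
      b₂ = a₁ ℚ.* a₁ ℚ.+ n (+ 4) ℚ.* a₂
      b₄ = n (+ 2) ℚ.* a₄ ℚ.+ a₁ ℚ.* a₃
      b₆ = a₃ ℚ.* a₃ ℚ.+ n (+ 4) ℚ.* a₆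
      b₈ = a₁ ℚ.* a₁ ℚ.* a₆ ℚ.+ n (+ 4) ℚ.* a₂ ℚ.* a₆ ℚ.- a₁ ℚ.* a₃ ℚ.* a₄
           ℚ.+ a₂ ℚ.* a₃ ℚ.* a₃ ℚ.- a₄ ℚ.* a₄
  in ℚ.- (b₂ ℚ.* b₂ ℚ.* b₈) ℚ.- n (+ 8) ℚ.* b₄ ℚ.* b₄ ℚ.* b₄
     ℚ.- n (+ 27) ℚ.* b₆ ℚ.* b₆ ℚ.+ n (+ 9) ℚ.* b₂ ℚ.* b₄ ℚ.* b₆

EllipticCurveℚ : Set
EllipticCurveℚ = Σ Weierstrassℚ λ W → ¬ (Δℚ W ≡ 0ℚ)

-- E : y² = x³ + A x² + B x (so a₁ = a₃ = a₆ = 0, a₂ = A, a₄ = B) is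
-- isomorphic over ℚ(t) to the curve W defined over ℚ: there are
-- u, r, s, w ∈ ℚ(t), u ≠ 0, such that the change of variables
--   x = u² x' + r ,  y = u³ y' + s u² x' + w
-- carries E to W, i.e. (Silverman, Table 3.1)
--   u  a₁' = a₁ + 2s
--   u² a₂' = a₂ − s a₁ + 3r − s²
--   u³ a₃' = a₃ + r a₁ + 2w
--   u⁴ a₄' = a₄ − s a₃ + 2r a₂ − (w + r s) a₁ + 3r² − 2sw
--   u⁶ a₆' = a₆ + r a₄ + r² a₂ + r³ − w a₃ − w² − r w a₁
IsoOverℚ⟨t⟩ : Poly → Poly → Weierstrassℚ → Set
IsoOverℚ⟨t⟩ A B (weier b₁ b₂ b₃ b₄ b₆) =
  Σ Frac λ u → Σ Frac λ r → Σ Frac λ s → Σ Frac λ w →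
    WF u × WF r × WF s × WF w × ¬ (u ≈F 0F) ×
    (u *F ratF b₁ ≈F intF (+ 2) *F s) ×
    (u *F u *F ratF b₂ ≈F polyF A +F intF (+ 3) *F r -F s *F s) ×
    (u *F u *F u *F ratF b₃ ≈F intF (+ 2) *F w) ×
    (u *F u *F u *F u *F ratF b₄
       ≈F polyF B +F intF (+ 2) *F r *F polyF A +F intF (+ 3) *F r *F r
          -F intF (+ 2) *F s *F w) ×
    (u *F u *F u *F u *F u *F u *F ratF b₆
       ≈F r *F polyF B +F r *F r *F polyF A +F r *F r *F r -F w *F w)

Nonconstant : Poly → Poly → Set
Nonconstant A B = ¬ (Σ EllipticCurveℚ λ W → IsoOverℚ⟨t⟩ A B (proj₁ W))

cubicAt : Poly → Poly → ℚ → ℚ → ℚ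
cubicAt A B t₀ x = x ℚ.* x ℚ.* x ℚ.+ eval A t₀ ℚ.* x ℚ.* x ℚ.+ eval B t₀ ℚ.* x

ExactlyOneRationalRoot : (ℚ → ℚ) → Set
ExactlyOneRationalRoot f = Σ ℚ λ r → (f r ≡ 0ℚ) × (∀ x → f x ≡ 0ℚ → x ≡ r)

{-# OPTIONS --safe #-}
module Submission where

-- A rational root of x³ + a x² + b x is either 0 or a root of x² + a x + b, and a root r of
-- the latter makes a² − 4b = (2r + a)² a square. Under the hypothesis on t₀, a square value
-- of A² − 4B at t₀ would make A² − 4B a square in ℤ[t], so 0 is the only root. The same
-- hypothesis gives B(t₀) ≠ 0: otherwise both B and −B take the square value 0, hence are
-- squares in ℤ[t], and g² + k² = 0 forces g = 0, i.e. B = 0 and D = 0. Since A² − 4B(t₀) is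
-- not a square it is nonzero, so D(t₀) = B(t₀)²(A² − 4B)(t₀) ≠ 0.

open import Defs
open import Data.Nat using (zero; suc)
open import Data.Integer as ℤ using (+_; -[1+_]; +[1+_])
import Data.Integer.Properties as ℤ
open import Data.Rational as ℚ using (ℚ; 0ℚ; mkℚ)
import Data.Rational.Properties as ℚ
import Data.Nat.Coprimality as Coprimality
open import Data.Rational.Solver using (module +-*-Solver)
open import Data.List using ([]; _∷_; map; drop)
open import Data.Product using (_×_; _,_)
open import Data.Sum using (_⊎_; inj₁; inj₂; [_,_]′; map₂)
open import Function using (id; _∘_; _⟨_⟩_)
open import Relation.Nullary using (¬_; yes; no; contradiction)
open import Relation.Binary.PropositionalEquality

open +-*-Solver

toℚ≡mkℚ : ∀ z → toℚ z ≡ mkℚ z 0 (Coprimality.sym (Coprimality.1-coprimeTo ℤ.∣ z ∣))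
toℚ≡mkℚ (+ n)    = ℚ.normalize-coprime (Coprimality.sym (Coprimality.1-coprimeTo n))
toℚ≡mkℚ -[1+ n ] = cong ℚ.-_ (ℚ.normalize-coprime (Coprimality.sym (Coprimality.1-coprimeTo (suc n))))

toℚ-homo-+ : ∀ a b → toℚ (a ℤ.+ b) ≡ toℚ a ℚ.+ toℚ b
toℚ-homo-+ a b rewrite toℚ≡mkℚ a | toℚ≡mkℚ b | ℤ.*-identityʳ a | ℤ.*-identityʳ b = refl

toℚ-homo-* : ∀ a b → toℚ (a ℤ.* b) ≡ toℚ a ℚ.* toℚ b
toℚ-homo-* a b rewrite toℚ≡mkℚ a | toℚ≡mkℚ b = refl

toℚ-homo‿- : ∀ a → toℚ (ℤ.- a) ≡ ℚ.- toℚ a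
toℚ-homo‿- (+ zero)  = refl
toℚ-homo‿- +[1+ n ] = refl
toℚ-homo‿- -[1+ n ] rewrite toℚ≡mkℚ -[1+ n ] | toℚ≡mkℚ +[1+ n ] = refl

i*i+j*j≡0⇒i≡0 : ∀ i j → i ℤ.* i ℤ.+ j ℤ.* j ≡ + 0 → i ≡ + 0
i*i+j*j≡0⇒i≡0 (+ zero)  _         _  = refl
i*i+j*j≡0⇒i≡0 +[1+ n ] (+ zero)  ()
i*i+j*j≡0⇒i≡0 +[1+ n ] +[1+ m ] ()
i*i+j*j≡0⇒i≡0 +[1+ n ] -[1+ m ] ()
i*i+j*j≡0⇒i≡0 -[1+ n ] (+ zero)  ()
i*i+j*j≡0⇒i≡0 -[1+ n ] +[1+ m ] ()
i*i+j*j≡0⇒i≡0 -[1+ n ] -[1+ m ] ()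

p*q≡0⇒p≡0∨q≡0 : ∀ p q → p ℚ.* q ≡ 0ℚ → p ≡ 0ℚ ⊎ q ≡ 0ℚ
p*q≡0⇒p≡0∨q≡0 p q pq≡0 with p ℚ.≟ 0ℚ
... | yes p≡0 = inj₁ p≡0
... | no  p≢0 = inj₂ (begin
  q                   ≡⟨ sym (ℚ.*-identityˡ q) ⟩
  ℚ.1ℚ ℚ.* q          ≡⟨ cong (ℚ._* q) (sym (ℚ.*-inverseˡ p)) ⟩
  ℚ.1/ p ℚ.* p ℚ.* q  ≡⟨ ℚ.*-assoc (ℚ.1/ p) p q ⟩
  ℚ.1/ p ℚ.* (p ℚ.* q) ≡⟨ cong (ℚ.1/ p ℚ.*_) pq≡0 ⟩
  ℚ.1/ p ℚ.* 0ℚ       ≡⟨ ℚ.*-zeroʳ (ℚ.1/ p) ⟩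
  0ℚ                  ∎)
  where
  open ≡-Reasoning
  instance _ = ℚ.≢-nonZero p≢0

coeff-+ₚ : ∀ p q n → coeff (p +ₚ q) n ≡ coeff p n ℤ.+ coeff q n
coeff-+ₚ []      q       n       = sym (ℤ.+-identityˡ _)
coeff-+ₚ (a ∷ p) []      n       = sym (ℤ.+-identityʳ _)
coeff-+ₚ (a ∷ p) (b ∷ q) zero    = refl
coeff-+ₚ (a ∷ p) (b ∷ q) (suc n) = coeff-+ₚ p q n

coeff-scale : ∀ a q n → coeff (map (a ℤ.*_) q) n ≡ a ℤ.* coeff q n
coeff-scale a []      n       = sym (ℤ.*-zeroʳ a)
coeff-scale a (b ∷ q) zero    = refl
coeff-scale a (b ∷ q) (suc n) = coeff-scale a q n

coeff-negₚ : ∀ p n → coeff (negₚ p) n ≡ ℤ.- coeff p n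
coeff-negₚ []      n       = refl
coeff-negₚ (a ∷ p) zero    = refl
coeff-negₚ (a ∷ p) (suc n) = coeff-negₚ p n

coeff-*ₚ-constₚ : ∀ p c n → coeff (p *ₚ constₚ c) n ≡ coeff p n ℤ.* c
coeff-*ₚ-constₚ []      c n       = sym (ℤ.*-zeroˡ c)
coeff-*ₚ-constₚ (a ∷ p) c zero    = ℤ.+-identityʳ (a ℤ.* c)
coeff-*ₚ-constₚ (a ∷ p) c (suc n) = coeff-*ₚ-constₚ p c n

*ₚ-zeroˡ : ∀ p q → p ≈ₚ 0ₚ → p *ₚ q ≈ₚ 0ₚ
*ₚ-zeroˡ []      q p≈0 n = refl
*ₚ-zeroˡ (a ∷ p) q p≈0 n rewrite coeff-+ₚ (map (a ℤ.*_) q) (+ 0 ∷ (p *ₚ q)) n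
  | coeff-scale a q n | p≈0 zero | ℤ.*-zeroˡ (coeff q n) with n
... | zero  = refl
... | suc m = trans (ℤ.+-identityˡ _) (*ₚ-zeroˡ p q (p≈0 ∘ suc) m)

coeff₀-*ₚ-shiftʳ : ∀ p q → coeff (p *ₚ (+ 0 ∷ q)) zero ≡ + 0
coeff₀-*ₚ-shiftʳ []      q = refl
coeff₀-*ₚ-shiftʳ (a ∷ p) q = cong (ℤ._+ + 0) (ℤ.*-zeroʳ a)

coeff-*ₚ-shiftʳ : ∀ p q n → coeff (p *ₚ (+ 0 ∷ q)) (suc n) ≡ coeff (p *ₚ q) n
coeff-*ₚ-shiftʳ []      q n = refl
coeff-*ₚ-shiftʳ (a ∷ p) q n rewrite coeff-+ₚ (map (a ℤ.*_) q) (p *ₚ (+ 0 ∷ q)) n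
  | coeff-+ₚ (map (a ℤ.*_) q) (+ 0 ∷ (p *ₚ q)) n = cong (ℤ._+_ (coeff (map (a ℤ.*_) q) n)) (shifted n)
  where
  shifted : ∀ n → coeff (p *ₚ (+ 0 ∷ q)) n ≡ coeff (+ 0 ∷ (p *ₚ q)) n
  shifted zero    = coeff₀-*ₚ-shiftʳ p q
  shifted (suc m) = coeff-*ₚ-shiftʳ p q m

coeff-square-shift : ∀ g n → coeff ((+ 0 ∷ g) *ₚ (+ 0 ∷ g)) (suc (suc n)) ≡ coeff (g *ₚ g) n
coeff-square-shift g n
  rewrite coeff-+ₚ (map (+ 0 ℤ.*_) (+ 0 ∷ g)) (+ 0 ∷ (g *ₚ (+ 0 ∷ g))) (suc (suc n))
        | coeff-scale (+ 0) (+ 0 ∷ g) (suc (suc n)) | ℤ.*-zeroˡ (coeff g (suc n))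
  = trans (ℤ.+-identityˡ _) (coeff-*ₚ-shiftʳ g g n)

SumOfSquaresVanishes : Poly → Poly → Set
SumOfSquaresVanishes g k = ∀ n → coeff (g *ₚ g) n ℤ.+ coeff (k *ₚ k) n ≡ + 0

sum-of-squares-swap : ∀ g k → SumOfSquaresVanishes g k → SumOfSquaresVanishes k g
sum-of-squares-swap g k vanishes n =
  trans (ℤ.+-comm (coeff (k *ₚ k) n) (coeff (g *ₚ g) n)) (vanishes n)

sum-of-squares-head : ∀ g k → SumOfSquaresVanishes g k → coeff g zero ≡ + 0
sum-of-squares-head []      k       vanishes = refl
sum-of-squares-head (a ∷ g) []      vanishes =
  i*i+j*j≡0⇒i≡0 a (+ 0) (cong (ℤ._+ + 0) (sym (ℤ.+-identityʳ (a ℤ.* a))) ⟨ trans ⟩ vanishes zero)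
sum-of-squares-head (a ∷ g) (b ∷ k) vanishes =
  i*i+j*j≡0⇒i≡0 a b (cong₂ ℤ._+_ (sym (ℤ.+-identityʳ (a ℤ.* a))) (sym (ℤ.+-identityʳ (b ℤ.* b)))
                      ⟨ trans ⟩ vanishes zero)

-- Once the constant terms are 0, coefficient n + 2 of g² is coefficient n of (g/t)².
sum-of-squares-tail : ∀ g k → SumOfSquaresVanishes g k →
                      SumOfSquaresVanishes (drop 1 g) (drop 1 k)
sum-of-squares-tail g k vanishes n =
  cong₂ ℤ._+_ (sym (square-shift g (sum-of-squares-head g k vanishes)))
              (sym (square-shift k (sum-of-squares-head k g (sum-of-squares-swap g k vanishes))))
  ⟨ trans ⟩ vanishes (suc (suc n))
  where
  square-shift : ∀ h → coeff h zero ≡ + 0 →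
                 coeff (h *ₚ h) (suc (suc n)) ≡ coeff (drop 1 h *ₚ drop 1 h) n
  square-shift []      _    = refl
  square-shift (_ ∷ h) refl = coeff-square-shift h n

sum-of-squares-vanishes⇒≈0 : ∀ g k → SumOfSquaresVanishes g k → g ≈ₚ 0ₚ
sum-of-squares-vanishes⇒≈0 g k vanishes zero = sum-of-squares-head g k vanishes
sum-of-squares-vanishes⇒≈0 []      k vanishes (suc n) = refl
sum-of-squares-vanishes⇒≈0 (a ∷ g) k vanishes (suc n) =
  sum-of-squares-vanishes⇒≈0 g (drop 1 k) (sum-of-squares-tail (a ∷ g) k vanishes) n

square∧negₚ-square⇒≈0 : ∀ p → IsSquareℤ[t] p → IsSquareℤ[t] (negₚ p) → p ≈ₚ 0ₚ
square∧negₚ-square⇒≈0 p (g , g²≈p) (k , k²≈-p) n =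
  sym (g²≈p n) ⟨ trans ⟩ *ₚ-zeroˡ g g (sum-of-squares-vanishes⇒≈0 g k vanishes) n
  where
  vanishes : SumOfSquaresVanishes g k
  vanishes m rewrite g²≈p m | k²≈-p m | coeff-negₚ p m = ℤ.+-inverseʳ (coeff p m)

∣ₚ-refl : ∀ p → p ∣ₚ p
∣ₚ-refl p = constₚ (+ 1) , λ n → coeff-*ₚ-constₚ p (+ 1) n ⟨ trans ⟩ ℤ.*-identityʳ (coeff p n)

negₚ-∣ₚ : ∀ p → negₚ p ∣ₚ p
negₚ-∣ₚ p = constₚ -[1+ 0 ] , λ n → begin
  coeff (negₚ p *ₚ constₚ -[1+ 0 ]) n ≡⟨ coeff-*ₚ-constₚ (negₚ p) -[1+ 0 ] n ⟩
  coeff (negₚ p) n ℤ.* -[1+ 0 ]       ≡⟨ cong (ℤ._* -[1+ 0 ]) (coeff-negₚ p n) ⟩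
  ℤ.- coeff p n ℤ.* -[1+ 0 ]          ≡⟨ ℤ.*-comm (ℤ.- coeff p n) -[1+ 0 ] ⟩
  -[1+ 0 ] ℤ.* ℤ.- coeff p n          ≡⟨ ℤ.-1*i≡-i (ℤ.- coeff p n) ⟩
  ℤ.- ℤ.- coeff p n                   ≡⟨ ℤ.neg-involutive (coeff p n) ⟩
  coeff p n                           ∎
  where open ≡-Reasoning

eval-+ₚ : ∀ p q x → eval (p +ₚ q) x ≡ eval p x ℚ.+ eval q x
eval-+ₚ []      q       x = sym (ℚ.+-identityˡ _)
eval-+ₚ (a ∷ p) []      x = sym (ℚ.+-identityʳ _)
eval-+ₚ (a ∷ p) (b ∷ q) x rewrite toℚ-homo-+ a b | eval-+ₚ p q x =
  solve 5 (λ a b x p q → a :+ b :+ x :* (p :+ q) := a :+ x :* p :+ (b :+ x :* q))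
    refl (toℚ a) (toℚ b) x (eval p x) (eval q x)

eval-scale : ∀ a q x → eval (map (a ℤ.*_) q) x ≡ toℚ a ℚ.* eval q x
eval-scale a []      x = sym (ℚ.*-zeroʳ (toℚ a))
eval-scale a (b ∷ q) x rewrite toℚ-homo-* a b | eval-scale a q x =
  solve 4 (λ a b x q → a :* b :+ x :* (a :* q) := a :* (b :+ x :* q))
    refl (toℚ a) (toℚ b) x (eval q x)

eval-negₚ : ∀ p x → eval (negₚ p) x ≡ ℚ.- eval p x
eval-negₚ []      x = refl
eval-negₚ (a ∷ p) x rewrite toℚ-homo‿- a | eval-negₚ p x =
  solve 3 (λ a x p → :- a :+ x :* (:- p) := :- (a :+ x :* p)) refl (toℚ a) x (eval p x)

eval-*ₚ : ∀ p q x → eval (p *ₚ q) x ≡ eval p x ℚ.* eval q x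
eval-*ₚ []      q x = sym (ℚ.*-zeroˡ (eval q x))
eval-*ₚ (a ∷ p) q x
  rewrite eval-+ₚ (map (a ℤ.*_) q) (+ 0 ∷ (p *ₚ q)) x | eval-scale a q x | eval-*ₚ p q x =
  solve 4 (λ a x p q → a :* q :+ (con 0ℚ :+ x :* (p :* q)) := (a :+ x :* p) :* q)
    refl (toℚ a) x (eval p x) (eval q x)

eval-constₚ : ∀ c x → eval (constₚ c) x ≡ toℚ c
eval-constₚ c x rewrite ℚ.*-zeroʳ x = ℚ.+-identityʳ (toℚ c)

eval≡0∧divisor-squares-lift⇒≈0 : ∀ p x →
  (∀ h → h ∣ₚ p → IsSquareℚ (eval h x) → IsSquareℤ[t] h) → eval p x ≡ 0ℚ → p ≈ₚ 0ₚ
eval≡0∧divisor-squares-lift⇒≈0 p x squares-lift p[x]≡0 = square∧negₚ-square⇒≈0 p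
  (squares-lift p (∣ₚ-refl p) (0ℚ , sym p[x]≡0))
  (squares-lift (negₚ p) (negₚ-∣ₚ p) (0ℚ , sym (eval-negₚ p x ⟨ trans ⟩ cong ℚ.-_ p[x]≡0)))

eval-discQuad : ∀ A B x →
  eval (discQuad A B) x ≡ eval A x ℚ.* eval A x ℚ.- toℚ (+ 4) ℚ.* eval B x
eval-discQuad A B x
  rewrite eval-+ₚ (A *ₚ A) (negₚ (constₚ (+ 4) *ₚ B)) x | eval-*ₚ A A x
        | eval-negₚ (constₚ (+ 4) *ₚ B) x | eval-*ₚ (constₚ (+ 4)) B x | eval-constₚ (+ 4) x
  = refl

eval-Dpoly : ∀ A B x →
  eval (Dpoly A B) x ≡ eval B x ℚ.* eval B x ℚ.* eval (discQuad A B) x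
eval-Dpoly A B x rewrite eval-*ₚ (B *ₚ B) (discQuad A B) x | eval-*ₚ B B x = refl

cubic-root-zero : ∀ a b → 0ℚ ℚ.* 0ℚ ℚ.* 0ℚ ℚ.+ a ℚ.* 0ℚ ℚ.* 0ℚ ℚ.+ b ℚ.* 0ℚ ≡ 0ℚ
cubic-root-zero = solve 2 (λ a b →
  con 0ℚ :* con 0ℚ :* con 0ℚ :+ a :* con 0ℚ :* con 0ℚ :+ b :* con 0ℚ := con 0ℚ) refl

four-times : ∀ b → toℚ (+ 4) ℚ.* b ≡ b ℚ.+ b ℚ.+ b ℚ.+ b
four-times = solve 1 (λ b → con (toℚ (+ 4)) :* b := b :+ b :+ b :+ b) refl

cubic-root⇒≡0∨completes-square : ∀ a b x →
  x ℚ.* x ℚ.* x ℚ.+ a ℚ.* x ℚ.* x ℚ.+ b ℚ.* x ≡ 0ℚ →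
  x ≡ 0ℚ ⊎ (x ℚ.+ x ℚ.+ a) ℚ.* (x ℚ.+ x ℚ.+ a) ≡ a ℚ.* a ℚ.- toℚ (+ 4) ℚ.* b
cubic-root⇒≡0∨completes-square a b x root =
  map₂ completes-square (p*q≡0⇒p≡0∨q≡0 x quadratic (factor ⟨ trans ⟩ root))
  where
  open ≡-Reasoning
  quadratic = x ℚ.* x ℚ.+ a ℚ.* x ℚ.+ b

  factor : x ℚ.* quadratic ≡ x ℚ.* x ℚ.* x ℚ.+ a ℚ.* x ℚ.* x ℚ.+ b ℚ.* x
  factor = solve 3 (λ x a b → x :* (x :* x :+ a :* x :+ b) := x :* x :* x :+ a :* x :* x :+ b :* x)
    refl x a b

  completes-square : quadratic ≡ 0ℚ →
    (x ℚ.+ x ℚ.+ a) ℚ.* (x ℚ.+ x ℚ.+ a) ≡ a ℚ.* a ℚ.- toℚ (+ 4) ℚ.* b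
  completes-square quadratic≡0 = begin
    (x ℚ.+ x ℚ.+ a) ℚ.* (x ℚ.+ x ℚ.+ a)
      ≡⟨ solve 3 (λ x a b → (x :+ x :+ a) :* (x :+ x :+ a)
           := a :* a :- (b :+ b :+ b :+ b) :+ ((x :* x :+ a :* x :+ b) :+ (x :* x :+ a :* x :+ b)
                                               :+ (x :* x :+ a :* x :+ b) :+ (x :* x :+ a :* x :+ b)))
           refl x a b ⟩
    a ℚ.* a ℚ.- (b ℚ.+ b ℚ.+ b ℚ.+ b) ℚ.+ (quadratic ℚ.+ quadratic ℚ.+ quadratic ℚ.+ quadratic)
      ≡⟨ cong (λ q → a ℚ.* a ℚ.- (b ℚ.+ b ℚ.+ b ℚ.+ b) ℚ.+ (q ℚ.+ q ℚ.+ q ℚ.+ q)) quadratic≡0 ⟩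
    a ℚ.* a ℚ.- (b ℚ.+ b ℚ.+ b ℚ.+ b) ℚ.+ 0ℚ
      ≡⟨ ℚ.+-identityʳ _ ⟩
    a ℚ.* a ℚ.- (b ℚ.+ b ℚ.+ b ℚ.+ b)
      ≡⟨ cong (λ c → a ℚ.* a ℚ.- c) (four-times b) ⟨
    a ℚ.* a ℚ.- toℚ (+ 4) ℚ.* b ∎

lemma3p1 : (A B : Poly) →
    ¬ IsSquareℤ[t] (discQuad A B) →
    IsElliptic A B →
    Nonconstant A B →
    (t₀ : ℚ) →
    ((h : Poly) → (h ∣ₚ B ⊎ h ∣ₚ discQuad A B) →
       IsSquareℚ (eval h t₀) → IsSquareℤ[t] h) →
    (eval (Dpoly A B) t₀ ≢ 0ℚ) × ExactlyOneRationalRoot (cubicAt A B t₀)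
lemma3p1 A B disc-nonsquare elliptic _ t₀ squares-lift =
  D[t₀]≢0 , 0ℚ , cubic-root-zero a b , root-unique
  where
  a b : ℚ
  a = eval A t₀
  b = eval B t₀

  disc[t₀]-nonsquare : ¬ IsSquareℚ (eval (discQuad A B) t₀)
  disc[t₀]-nonsquare = disc-nonsquare ∘ squares-lift (discQuad A B) (inj₂ (∣ₚ-refl (discQuad A B)))

  b≢0 : b ≢ 0ℚ
  b≢0 = elliptic ∘ *ₚ-zeroˡ (B *ₚ B) (discQuad A B) ∘ *ₚ-zeroˡ B B
      ∘ eval≡0∧divisor-squares-lift⇒≈0 B t₀ (λ h → squares-lift h ∘ inj₁)

  D[t₀]≢0 : eval (Dpoly A B) t₀ ≢ 0ℚ
  D[t₀]≢0 D≡0 with p*q≡0⇒p≡0∨q≡0 (b ℚ.* b) _ (sym (eval-Dpoly A B t₀) ⟨ trans ⟩ D≡0)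
  ... | inj₁ b²≡0   = [ b≢0 , b≢0 ]′ (p*q≡0⇒p≡0∨q≡0 b b b²≡0)
  ... | inj₂ disc≡0 = disc[t₀]-nonsquare (0ℚ , sym disc≡0)

  root-unique : ∀ x → cubicAt A B t₀ x ≡ 0ℚ → x ≡ 0ℚ
  root-unique x root = [ id , disc-square ]′ (cubic-root⇒≡0∨completes-square a b x root)
    where
    disc-square : (x ℚ.+ x ℚ.+ a) ℚ.* (x ℚ.+ x ℚ.+ a) ≡ a ℚ.* a ℚ.- toℚ (+ 4) ℚ.* b → x ≡ 0ℚ
    disc-square square =
      contradiction (x ℚ.+ x ℚ.+ a , (square ⟨ trans ⟩ sym (eval-discQuad A B t₀))) disc[t₀]-nonsquare
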